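{- The function $\mathrm{Fin}$ is not $(\mathcal{U},\varepsilon)$-definable. Further, no $(\mathcal{U},\varepsilon)$-definable function $F:2^{\mathbb{N}}\to2^{\mathbb{N}}$ satisfies, for all finite non-empty $t\subseteq\mathbb{N}$, any one of the following conditions: (a) $F(t)=\{0\}$ if $|t|$ is even and $F(t)=\emptyset$ otherwise; (b) $F(t)=\{0\}$ if $\max(t)$ is even and $F(t)=\emptyset$ otherwise; (c) $F(t)=\{0\}$ if $\sum_{n\in t}n$ is even and $F(t)=\emptyset$ otherwise.
   Context: $\mathbb{N}=\{0,1,2,\ldots\}$, $2^{\mathbb{N}}$ is its power set. A set-function is a map $(2^{\mathbb{N}})^k\to 2^{\mathbb{N}}$ for some $k\ge 0$. For a collection $\mathcal{O}$ of set-functions, $\mathcal{O}$-circuits are terms built from variables ranging over $2^{\mathbb{N}}$, the constants $\emptyset$, $\mathbb{N}$, $\{n\}$ ($n\in\mathbb{N}$), the operations $\cup$, $\cap$, complement relative to $\mathbb{N}$, and the functions in $\mathcal{O}$; a set-function is $\mathcal{O}$-definable if some $\mathcal{O}$-circuit evaluates to it; "$(\mathcal{U},\varepsilon)$-definable" means $(\mathcal{U}\cup\{\varepsilon\})$-definable. For $s\subseteq\mathbb{N}$, $s_{|m}=s\cap\{0,\ldots,m\}$, componentwise on tuples. A set-function $G$ of arity $n$ is continuous at $\vec s$ if for every $m$ there is $n'$ such that for all $\vec t$, $\vec t_{|n'}=\vec s_{|n'}$ implies $G(\vec t)_{|m}=G(\vec s)_{|m}$; $\mathcal{U}$ is the collection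 of all set-functions (all arities) continuous everywhere. $\varepsilon(x)=\{0\}$ if $x=\emptyset$, $\emptyset$ otherwise; $\mathrm{Fin}(x)=\{0\}$ if $x$ is finite, $\emptyset$ otherwise. -}

module Defs where

open import Data.Nat using (ℕ; zero; suc; _+_; _*_; _≤_; _<_; _⊔_)
open import Data.Nat.Divisibility using (_∣_)
open import Data.Bool using (Bool; true; false; _∨_; _∧_; not; if_then_else_)
open import Data.Fin using (Fin)
open import Data.Product using (Σ; ∃; _×_; _,_)
open import Relation.Binary.PropositionalEquality using (_≡_)
open import Relation.Nullary using (¬_)

Subset : Set
Subset = ℕ → Bool

_≐_ : Subset → Subset → Set
x ≐ y = ∀ n → x n ≡ y n
infix 4 _≐_

∅ : Subset
∅ _ = false

Nat : Subset
Nat _ = true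

⟦_⟧ : ℕ → Subset
⟦ m ⟧ n = Data.Nat._≡ᵇ_ n m

_∪_ : Subset → Subset → Subset
(x ∪ y) n = x n ∨ y n

_∩_ : Subset → Subset → Subset
(x ∩ y) n = x n ∧ y n

∁ : Subset → Subset
∁ x n = not (x n)

Indicates : Set → Subset → Set
Indicates P y = (P → y ≐ ⟦ 0 ⟧) × (¬ P → y ≐ ∅)

IsEmpty : Subset → Set
IsEmpty x = ∀ n → x n ≡ false

NonEmpty : Subset → Set
NonEmpty x = ∃ λ n → x n ≡ true

BoundedBy : Subset → ℕ → Set
BoundedBy x b = ∀ n → x n ≡ true → n < b

IsFinite : Subset → Set
IsFinite x = ∃ λ b → BoundedBy x b

-- The function ε (given as a specification: ε(x) = {0} if x = ∅, ∅ otherwise).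
IsEps : (Subset → Subset) → Set
IsEps e = ∀ x → Indicates (IsEmpty x) (e x)

-- restriction s|m = s ∩ {0,…,m}, componentwise on tuples
AgreeUpTo : ℕ → Subset → Subset → Set
AgreeUpTo m s t = ∀ j → j ≤ m → s j ≡ t j

AgreeUpToᵛ : ∀ {k} → ℕ → (Fin k → Subset) → (Fin k → Subset) → Set
AgreeUpToᵛ m s t = ∀ i → AgreeUpTo m (s i) (t i)

ContinuousAt : ∀ {k} → ((Fin k → Subset) → Subset) → (Fin k → Subset) → Set
ContinuousAt G s =
  ∀ m → ∃ λ n' → ∀ t → AgreeUpToᵛ n' t s → AgreeUpTo m (G t) (G s)

-- membership in 𝒰: continuous everywhere
Continuous : ∀ {k} → ((Fin k → Subset) → Subset) → Set
Continuous G = ∀ s → ContinuousAt G s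

data Circuit (v : ℕ) : Set where
  var    : Fin v → Circuit v
  emptyC : Circuit v
  natC   : Circuit v
  single : ℕ → Circuit v
  union  : Circuit v → Circuit v → Circuit v
  inter  : Circuit v → Circuit v → Circuit v
  compl  : Circuit v → Circuit v
  epsC   : Circuit v → Circuit v
  app    : (k : ℕ) (G : (Fin k → Subset) → Subset) → Continuous G →
           (Fin k → Circuit v) → Circuit v

eval : ∀ {v} → (Subset → Subset) → Circuit v → (Fin v → Subset) → Subset
eval e (var i)          ρ = ρ i
eval e emptyC           ρ = ∅
eval e natC             ρ = Nat
eval e (single m)       ρ = ⟦ m ⟧
eval e (union c d)      ρ = eval e c ρ ∪ eval e d ρ
eval e (inter c d)      ρ = eval e c ρ ∩ eval e d ρ
eval e (compl c)        ρ = ∁ (eval e c ρ)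
eval e (epsC c)         ρ = e (eval e c ρ)
eval e (app k G _ cs)   ρ = G (λ i → eval e (cs i) ρ)

Definable : (Subset → Subset) → (Subset → Subset) → Set
Definable e F = Σ (Circuit 1) λ C → ∀ x → eval e C (λ _ → x) ≐ F x

-- For a finite t ⊆ {0,…,b-1}: |t|, max t, Σ_{n∈t} n computed below the bound b.
card : Subset → ℕ → ℕ
card x zero = 0
card x (suc b) = (if x b then 1 else 0) + card x b

sumS : Subset → ℕ → ℕ
sumS x zero = 0
sumS x (suc b) = (if x b then b else 0) + sumS x b

maxS : Subset → ℕ → ℕ
maxS x zero = 0
maxS x (suc b) = if x b then b else maxS x b

Even : ℕ → Set
Even n = 2 ∣ n

SatisfiesOnFinNonEmpty : (Subset → Subset) → (Subset → ℕ → Set) → Set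
SatisfiesOnFinNonEmpty F P =
  ∀ t b → BoundedBy t b → NonEmpty t → Indicates (P t b) (F t)

CondA CondB CondC : (Subset → Subset) → Set
CondA F = SatisfiesOnFinNonEmpty F (λ t b → Even (card t b))
CondB F = SatisfiesOnFinNonEmpty F (λ t b → Even (maxS t b))
CondC F = SatisfiesOnFinNonEmpty F (λ t b → Even (sumS t b))

module Submission where

-- Give 2^ℕ its Cantor topology, with basic
-- neighbourhoods  N(q, m) = { t | t agrees with q on 0,…,m }.  Every
-- (𝒰,ε)-definable function is continuous on a dense open set: variables,
-- constants and Boolean operations preserve continuity pointwise, the
-- functions of 𝒰 are continuous, and ε — although discontinuous — is locally
-- constant on a dense open set (inside any neighbourhood either every set is
-- mapped to the empty set, or some set has a point which then persists on a
-- smaller neighbourhood).  Being constructive, "dense" is read through double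
-- negation, which suffices since the theorem is a negative statement.
--
-- Hence a definable F is continuous at some point q, so bit 0 of F is constant
-- on some neighbourhood N(q, N).  Each of the four properties oscillates on
-- every neighbourhood: grafting a suitable tail r onto the first N+1 bits of q
-- gives sets that are finite resp. infinite, or finite non-empty sets whose
-- cardinality, maximum or sum differ by exactly one.

open import Defs
open import Data.Bool using (Bool; true; false; _∨_; _∧_; not; if_then_else_)
open import Data.Bool.Properties using (¬-not)
open import Data.Fin using (Fin) renaming (zero to fzero; suc to fsuc)
open import Data.Nat using (ℕ; zero; suc; _+_; _≤_; _⊔_; z≤n; s≤s)
open import Data.Nat.Divisibility using (divides; ∣m+n∣m⇒∣n; ∣1⇒≡1)
open import Data.Nat.Properties
  using (≤-refl; ≤-trans; m≤m⊔n; m≤n⊔m; m≤n+m; n≤1+n; <⇒≱; +-comm; +-suc; +-identityʳ)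
open import Data.Product using (Σ; ∃; ∃₂; _×_; _,_; proj₁; proj₂)
open import Data.Sum using (_⊎_; inj₁; inj₂)
open import Effect.Monad using (RawMonad)
open import Function using (_∘_)
open import Level using (0ℓ)
open import Relation.Binary.PropositionalEquality
  using (_≡_; _≢_; refl; sym; trans; cong; cong₂; subst)
open import Relation.Nullary using (¬_; yes; no)
open import Relation.Nullary.Negation using (DoubleNegation; ¬¬-Monad)
open import Relation.Nullary.Decidable using (¬¬-excluded-middle)

open RawMonad (¬¬-Monad {0ℓ}) using (pure; _>>=_)

agree-refl : ∀ {m} {a : Subset} → AgreeUpTo m a a
agree-refl _ _ = refl

agree-sym : ∀ {m} {a b : Subset} → AgreeUpTo m a b → AgreeUpTo m b a
agree-sym a≈b j j≤m = sym (a≈b j j≤m)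

agree-trans : ∀ {m} {a b c : Subset} → AgreeUpTo m a b → AgreeUpTo m b c → AgreeUpTo m a c
agree-trans a≈b b≈c j j≤m = trans (a≈b j j≤m) (b≈c j j≤m)

agree-mono : ∀ {m m'} {a b : Subset} → m ≤ m' → AgreeUpTo m' a b → AgreeUpTo m a b
agree-mono m≤m' a≈b j j≤m = a≈b j (≤-trans j≤m m≤m')

true≢false : true ≢ false
true≢false ()

ContinuousAt₁ : (Subset → Subset) → Subset → Set
ContinuousAt₁ f y = ∀ k → ∃ λ n → ∀ z → AgreeUpTo n z y → AgreeUpTo k (f z) (f y)

continuous-resp : {f g : Subset → Subset} → (∀ x → f x ≐ g x) →
                  ∀ y → ContinuousAt₁ f y → ContinuousAt₁ g y
continuous-resp f≐g y cont k with cont k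
... | n , close = n , λ z z≈y j j≤k →
  trans (sym (f≐g z j)) (trans (close z z≈y j j≤k) (f≐g y j))

constant-near⇒continuous : ∀ (f : Subset → Subset) q m →
  (∀ z w → AgreeUpTo m z q → AgreeUpTo m w q → f z ≐ f w) →
  ∀ y → AgreeUpTo m y q → ContinuousAt₁ f y
constant-near⇒continuous f q m const y y≈q k =
  m , λ z z≈y j _ → const z y (agree-trans z≈y y≈q) y≈q j

-- Dense open sets (read through double negation): every basic neighbourhood
-- N(p, n) contains a basic neighbourhood N(centre, radius) on which Q holds.

record Refinement (Q : Subset → Set) (p : Subset) (n : ℕ) : Set where
  constructor refinement
  field
    centre  : Subset
    radius  : ℕ
    n≤r     : n ≤ radius
    inside  : AgreeUpTo n centre p
    holds   : ∀ y → AgreeUpTo radius y centre → Q y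

DenseOpen : (Subset → Set) → Set
DenseOpen Q = ∀ p n → DoubleNegation (Refinement Q p n)

dense-univ : {Q : Subset → Set} → (∀ y → Q y) → DenseOpen Q
dense-univ always p n = pure (refinement p n ≤-refl agree-refl (λ y _ → always y))

dense-mono : {Q Q' : Subset → Set} → (∀ y → Q y → Q' y) → DenseOpen Q → DenseOpen Q'
dense-mono Q⇒Q' dense p n = dense p n >>= λ where
  (refinement q m n≤m q≈p holds) → pure (refinement q m n≤m q≈p (λ y y≈q → Q⇒Q' y (holds y y≈q)))

dense-∩ : {Q₁ Q₂ : Subset → Set} → DenseOpen Q₁ → DenseOpen Q₂ → DenseOpen (λ y → Q₁ y × Q₂ y)
dense-∩ dense₁ dense₂ p n = dense₁ p n >>= λ where
  (refinement q₁ m₁ n≤m₁ q₁≈p holds₁) → dense₂ q₁ m₁ >>= λ where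
    (refinement q₂ m₂ m₁≤m₂ q₂≈q₁ holds₂) → pure (refinement q₂ m₂ (≤-trans n≤m₁ m₁≤m₂)
      (agree-trans (agree-mono n≤m₁ q₂≈q₁) q₁≈p)
      (λ y y≈q₂ → holds₁ y (agree-trans (agree-mono m₁≤m₂ y≈q₂) q₂≈q₁) , holds₂ y y≈q₂))

dense-⋂ : ∀ k (Q : Fin k → Subset → Set) → (∀ i → DenseOpen (Q i)) → DenseOpen (λ y → ∀ i → Q i y)
dense-⋂ zero    Q dense = dense-univ (λ y ())
dense-⋂ (suc k) Q dense =
  dense-mono cons (dense-∩ (dense fzero) (dense-⋂ k (Q ∘ fsuc) (dense ∘ fsuc)))
  where
  cons : ∀ y → Q fzero y × (∀ i → Q (fsuc i) y) → ∀ i → Q i y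
  cons y (here , there) fzero    = here
  cons y (here , there) (fsuc i) = there i

dense-inhabited : {Q : Subset → Set} → DenseOpen Q → DoubleNegation (∃ Q)
dense-inhabited dense = dense ∅ 0 >>= λ where
  (refinement q _ _ _ holds) → pure (q , holds q agree-refl)

pointwise₁-continuous : (op : Bool → Bool) (f : Subset → Subset) →
  ∀ y → ContinuousAt₁ f y → ContinuousAt₁ (λ x j → op (f x j)) y
pointwise₁-continuous op f y cont k with cont k
... | n , close = n , λ z z≈y j j≤k → cong op (close z z≈y j j≤k)

pointwise₂-continuous : (op : Bool → Bool → Bool) (f g : Subset → Subset) →
  ∀ y → ContinuousAt₁ f y → ContinuousAt₁ g y → ContinuousAt₁ (λ x j → op (f x j) (g x j)) y
pointwise₂-continuous op f g y cont-f cont-g k with cont-f k | cont-g k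
... | n₁ , close₁ | n₂ , close₂ = n₁ ⊔ n₂ , λ z z≈y j j≤k →
  cong₂ op (close₁ z (agree-mono (m≤m⊔n n₁ n₂) z≈y) j j≤k)
           (close₂ z (agree-mono (m≤n⊔m n₁ n₂) z≈y) j j≤k)

-- … and by composition with a continuous function of finitely many
-- arguments, whose moduli are bounded by a common one.

finite-bound : ∀ k (f : Fin k → ℕ) → ∃ λ B → ∀ i → f i ≤ B
finite-bound zero    f = 0 , λ ()
finite-bound (suc k) f with finite-bound k (f ∘ fsuc)
... | B , f≤B = f fzero ⊔ B , bounded
  where
  bounded : ∀ i → f i ≤ f fzero ⊔ B
  bounded fzero    = m≤m⊔n (f fzero) B
  bounded (fsuc i) = ≤-trans (f≤B i) (m≤n⊔m (f fzero) B)

composition-continuous : ∀ k (G : (Fin k → Subset) → Subset) → Continuous G →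
  (f : Fin k → Subset → Subset) → ∀ y → (∀ i → ContinuousAt₁ (f i) y) →
  ContinuousAt₁ (λ x → G (λ i → f i x)) y
composition-continuous k G cont-G f y cont-f m with cont-G (λ i → f i y) m
... | n , close-G with finite-bound k (λ i → proj₁ (cont-f i n))
...   | B , modulus≤B = B , λ z z≈y →
  close-G (λ i → f i z) (λ i → proj₂ (cont-f i n) z (agree-mono (modulus≤B i) z≈y))

module Epsilon (e : Subset → Subset) (is-ε : IsEps e) where

  ε-empty : ∀ x → IsEmpty x → e x ≐ ⟦ 0 ⟧
  ε-empty x = proj₁ (is-ε x)

  ε-nonempty : ∀ x j → x j ≡ true → e x ≐ ∅
  ε-nonempty x j xj = proj₂ (is-ε x) (λ empty → true≢false (trans (sym xj) (empty j)))

  -- If some y ∈ N(q, m) has c y ∋ j, continuity of c at y yields a smaller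
  -- neighbourhood on which every c z ∋ j, so ε ∘ c is constantly ∅ there.
  refine-at-point : ∀ (c : Subset → Subset) p n q m → n ≤ m → AgreeUpTo n q p →
    (∀ y → AgreeUpTo m y q → ContinuousAt₁ c y) →
    ∀ y j → AgreeUpTo m y q → c y j ≡ true → Refinement (ContinuousAt₁ (e ∘ c)) p n
  refine-at-point c p n q m n≤m q≈p cont y j y≈q cyj with cont y y≈q j
  ... | n' , close = refinement y (m ⊔ n') (≤-trans n≤m (m≤m⊔n m n'))
    (agree-trans (agree-mono n≤m y≈q) q≈p)
    (constant-near⇒continuous (e ∘ c) y (m ⊔ n') ε∘c-empty)
    where
    contains-j : ∀ z → AgreeUpTo (m ⊔ n') z y → c z j ≡ true
    contains-j z z≈y = trans (close z (agree-mono (m≤n⊔m m n') z≈y) j ≤-refl) cyj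
    ε∘c-empty : ∀ z w → AgreeUpTo (m ⊔ n') z y → AgreeUpTo (m ⊔ n') w y → e (c z) ≐ e (c w)
    ε∘c-empty z w z≈y w≈y i =
      trans (ε-nonempty (c z) j (contains-j z z≈y) i) (sym (ε-nonempty (c w) j (contains-j w w≈y) i))

  refine-where-empty : ∀ (c : Subset → Subset) p n q m → n ≤ m → AgreeUpTo n q p →
    (∀ y → AgreeUpTo m y q → IsEmpty (c y)) → Refinement (ContinuousAt₁ (e ∘ c)) p n
  refine-where-empty c p n q m n≤m q≈p empty =
    refinement q m n≤m q≈p (constant-near⇒continuous (e ∘ c) q m ε∘c-singleton)
    where
    ε∘c-singleton : ∀ z w → AgreeUpTo m z q → AgreeUpTo m w q → e (c z) ≐ e (c w)
    ε∘c-singleton z w z≈q w≈q i =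
      trans (ε-empty (c z) (empty z z≈q) i) (sym (ε-empty (c w) (empty w w≈q) i))

  dense-ε : (c : Subset → Subset) → DenseOpen (ContinuousAt₁ c) → DenseOpen (ContinuousAt₁ (e ∘ c))
  dense-ε c dense p n = dense p n >>= λ where
    (refinement q m n≤m q≈p cont) →
      ¬¬-excluded-middle {A = ∃₂ λ y j → AgreeUpTo m y q × c y j ≡ true} >>= λ where
        (yes (y , j , y≈q , cyj)) → pure (refine-at-point c p n q m n≤m q≈p cont y j y≈q cyj)
        (no none) → pure (refine-where-empty c p n q m n≤m q≈p
                            (λ y y≈q j → ¬-not (λ cyj → none (y , j , y≈q , cyj))))

  circuit-dense : (C : Circuit 1) → DenseOpen (ContinuousAt₁ (λ x → eval e C (λ _ → x)))
  circuit-dense (var i)        = dense-univ (λ y k → k , λ z z≈y → z≈y)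
  circuit-dense emptyC         = dense-univ (λ y k → 0 , λ _ _ _ _ → refl)
  circuit-dense natC           = dense-univ (λ y k → 0 , λ _ _ _ _ → refl)
  circuit-dense (single m)     = dense-univ (λ y k → 0 , λ _ _ _ _ → refl)
  circuit-dense (union c d)    = dense-mono (λ y (cont-c , cont-d) → pointwise₂-continuous _∨_ _ _ y cont-c cont-d)
                                            (dense-∩ (circuit-dense c) (circuit-dense d))
  circuit-dense (inter c d)    = dense-mono (λ y (cont-c , cont-d) → pointwise₂-continuous _∧_ _ _ y cont-c cont-d)
                                            (dense-∩ (circuit-dense c) (circuit-dense d))
  circuit-dense (compl c)      = dense-mono (pointwise₁-continuous not _) (circuit-dense c)
  circuit-dense (epsC c)       = dense-ε _ (circuit-dense c)
  circuit-dense (app k G cont-G cs) =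
    dense-mono (composition-continuous k G cont-G (λ i x → eval e (cs i) (λ _ → x)))
               (dense-⋂ k _ (λ i → circuit-dense (cs i)))

  definable-continuous-somewhere : ∀ F → Definable e F → DoubleNegation (∃ (ContinuousAt₁ F))
  definable-continuous-somewhere F (C , C≐F) = dense-inhabited (dense-mono (continuous-resp C≐F) (circuit-dense C))

Oscillates : (Subset → Subset) → Set
Oscillates F = ∀ q N → ∃₂ λ t₁ t₂ → AgreeUpTo N t₁ q × AgreeUpTo N t₂ q × F t₁ 0 ≢ F t₂ 0

continuous⇒¬oscillates : ∀ F q → ContinuousAt₁ F q → ¬ Oscillates F
continuous⇒¬oscillates F q cont osc with cont 0
... | N , close with osc q N
...   | t₁ , t₂ , t₁≈q , t₂≈q , differ = differ (trans (close t₁ t₁≈q 0 z≤n) (sym (close t₂ t₂≈q 0 z≤n)))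

definable⇒¬oscillates : ∀ e → IsEps e → ∀ F → Definable e F → ¬ Oscillates F
definable⇒¬oscillates e is-ε F def osc =
  Epsilon.definable-continuous-somewhere e is-ε F def (λ (q , cont) → continuous⇒¬oscillates F q cont osc)

-- Grafting: splice N q r agrees with q on 0,…,N and continues with r, i.e.
-- its element N+1+j is r j.

splice : ℕ → Subset → Subset → Subset
splice zero    q r zero    = q 0
splice zero    q r (suc j) = r j
splice (suc N) q r zero    = q 0
splice (suc N) q r (suc j) = splice N (q ∘ suc) r j

splice-agrees : ∀ N q r → AgreeUpTo N (splice N q r) q
splice-agrees zero    q r zero    _         = refl
splice-agrees (suc N) q r zero    _         = refl
splice-agrees (suc N) q r (suc j) (s≤s j≤N) = splice-agrees N (q ∘ suc) r j j≤N

splice-tail : ∀ N q r j → splice N q r (suc (N + j)) ≡ r j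
splice-tail zero    q r j = refl
splice-tail (suc N) q r j = splice-tail N (q ∘ suc) r j

splice-first : ∀ N q r → splice N q r (suc N) ≡ r 0
splice-first N q r = subst (λ i → splice N q r (suc i) ≡ r 0) (+-identityʳ N) (splice-tail N q r 0)

splice-second : ∀ N q r → splice N q r (suc (suc N)) ≡ r 1
splice-second N q r =
  subst (λ i → splice N q r (suc i) ≡ r 1) (trans (+-suc N 0) (cong suc (+-identityʳ N))) (splice-tail N q r 1)

splice-bounded : ∀ N q r b → BoundedBy r b → BoundedBy (splice N q r) (suc N + b)
splice-bounded zero    q r b r<b zero    _   = s≤s z≤n
splice-bounded zero    q r b r<b (suc j) rj  = s≤s (r<b j rj)
splice-bounded (suc N) q r b r<b zero    _   = s≤s z≤n
splice-bounded (suc N) q r b r<b (suc j) sj  = s≤s (splice-bounded N (q ∘ suc) r b r<b j sj)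

splices-agree : ∀ N q r r' → AgreeUpTo N (splice N q r) (splice N q r')
splices-agree N q r r' = agree-trans (splice-agrees N q r) (agree-sym (splice-agrees N q r'))

splice-empty-finite : ∀ N q → IsFinite (splice N q ∅)
splice-empty-finite N q = suc N + 0 , splice-bounded N q ∅ 0 (λ _ ())

splice-full-infinite : ∀ N q → ¬ IsFinite (splice N q Nat)
splice-full-infinite N q (b , bounded) =
  <⇒≱ (bounded (suc (N + b)) (splice-tail N q Nat b)) (m≤n+m b (suc N))

indicated : ∀ {P y} → Indicates P y → P → y 0 ≡ true
indicated (holds , _) p = holds p 0

not-indicated : ∀ {P y} → Indicates P y → ¬ P → y 0 ≡ false
not-indicated (_ , fails) ¬p = fails ¬p 0

finiteness-oscillates : ∀ F → (∀ x → Indicates (IsFinite x) (F x)) → Oscillates F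
finiteness-oscillates F indicates q N =
  splice N q ∅ , splice N q Nat , splice-agrees N q ∅ , splice-agrees N q Nat ,
  λ same → true≢false (trans (sym (indicated (indicates _) (splice-empty-finite N q)))
                        (trans same (not-indicated (indicates _) (splice-full-infinite N q))))

even-or-odd : ∀ n → Even n ⊎ Even (suc n)
even-or-odd zero    = inj₁ (divides 0 refl)
even-or-odd (suc n) with even-or-odd n
... | inj₁ (divides q n≡2q) = inj₂ (divides (suc q) (cong (suc ∘ suc) n≡2q))
... | inj₂ even = inj₁ even

¬even-and-odd : ∀ n → Even n → ¬ Even (suc n)
¬even-and-odd n even odd with ∣1⇒≡1 (∣m+n∣m⇒∣n (subst Even (+-comm 1 n) odd) even)
... | ()

parity-separates : ∀ {X Y a b} → Y ≡ suc X → Indicates (Even X) a → Indicates (Even Y) b → a 0 ≢ b 0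
parity-separates {X} refl ind-a ind-b same with even-or-odd X
... | inj₁ even = true≢false (trans (sym (indicated ind-a even)) (trans same (not-indicated ind-b (¬even-and-odd X even))))
... | inj₂ odd  = true≢false (sym (trans (sym (not-indicated ind-a (λ even → ¬even-and-odd X even odd))) (trans same (indicated ind-b odd))))

splice-pair-bounded : ∀ N q r → BoundedBy r 2 → BoundedBy (splice N q r) (3 + N)
splice-pair-bounded N q r r<2 = subst (BoundedBy (splice N q r)) (cong suc (+-comm N 2)) (splice-bounded N q r 2 r<2)

zero-only one-only zero-and-one : Subset
zero-only = ⟦ 0 ⟧
one-only = ⟦ 1 ⟧
zero-and-one = ⟦ 0 ⟧ ∪ ⟦ 1 ⟧

zero-only-bounded : BoundedBy zero-only 2
zero-only-bounded zero _ = s≤s z≤n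

one-only-bounded : BoundedBy one-only 2
one-only-bounded (suc zero) _ = s≤s (s≤s z≤n)

zero-and-one-bounded : BoundedBy zero-and-one 2
zero-and-one-bounded zero       _ = s≤s z≤n
zero-and-one-bounded (suc zero) _ = s≤s (s≤s z≤n)

card-agree : ∀ N {x y} → AgreeUpTo N x y → card x (suc N) ≡ card y (suc N)
card-agree zero    x≈y = cong (λ v → (if v then 1 else 0) + 0) (x≈y 0 z≤n)
card-agree (suc N) x≈y =
  cong₂ _+_ (cong (λ v → if v then 1 else 0) (x≈y (suc N) ≤-refl)) (card-agree N (agree-mono (n≤1+n N) x≈y))

sum-agree : ∀ N {x y} → AgreeUpTo N x y → sumS x (suc N) ≡ sumS y (suc N)
sum-agree zero    x≈y = cong (λ v → (if v then 0 else 0) + 0) (x≈y 0 z≤n)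
sum-agree (suc N) x≈y =
  cong₂ _+_ (cong (λ v → if v then suc N else 0) (x≈y (suc N) ≤-refl)) (sum-agree N (agree-mono (n≤1+n N) x≈y))

-- Adding the element N+2 to splice N q {0} raises the cardinality by one;
-- replacing its element N+1 by N+2 raises the maximum and the sum by one.

card-step : ∀ N q → card (splice N q zero-and-one) (3 + N) ≡ suc (card (splice N q zero-only) (3 + N))
card-step N q rewrite splice-second N q zero-and-one | splice-first N q zero-and-one | splice-second N q zero-only | splice-first N q zero-only =
  cong (suc ∘ suc) (card-agree N (splices-agree N q zero-and-one zero-only))

max-step : ∀ N q → maxS (splice N q one-only) (3 + N) ≡ suc (maxS (splice N q zero-only) (3 + N))
max-step N q rewrite splice-second N q one-only | splice-second N q zero-only | splice-first N q zero-only = refl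

sum-step : ∀ N q → sumS (splice N q one-only) (3 + N) ≡ suc (sumS (splice N q zero-only) (3 + N))
sum-step N q rewrite splice-second N q one-only | splice-first N q one-only | splice-second N q zero-only | splice-first N q zero-only =
  cong (λ v → suc (suc N + v)) (sum-agree N (splices-agree N q one-only zero-only))

parity-oscillates : ∀ F (stat : Subset → ℕ → ℕ) (r r' : Subset) →
  BoundedBy r 2 → BoundedBy r' 2 → NonEmpty r → NonEmpty r' →
  (∀ N q → stat (splice N q r') (3 + N) ≡ suc (stat (splice N q r) (3 + N))) →
  SatisfiesOnFinNonEmpty F (λ t b → Even (stat t b)) → Oscillates F
parity-oscillates F stat r r' r<2 r'<2 (i , ri) (i' , r'i') step satisfies q N =
  splice N q r , splice N q r' , splice-agrees N q r , splice-agrees N q r' ,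
  parity-separates (step N q)
    (satisfies _ _ (splice-pair-bounded N q r r<2) (suc (N + i) , trans (splice-tail N q r i) ri))
    (satisfies _ _ (splice-pair-bounded N q r' r'<2) (suc (N + i') , trans (splice-tail N q r' i') r'i'))

corollary3 : (e : Subset → Subset) → IsEps e →
    (¬ Σ (Subset → Subset) (λ F → Definable e F × (∀ x → Indicates (IsFinite x) (F x))))
    × (∀ F → Definable e F → ¬ (CondA F ⊎ CondB F ⊎ CondC F))
corollary3 e is-ε = no-finiteness-test , no-parity-test
  where
  no-finiteness-test : ¬ Σ (Subset → Subset) (λ F → Definable e F × (∀ x → Indicates (IsFinite x) (F x)))
  no-finiteness-test (F , def , indicates) =
    definable⇒¬oscillates e is-ε F def (finiteness-oscillates F indicates)

  no-parity-test : ∀ F → Definable e F → ¬ (CondA F ⊎ CondB F ⊎ CondC F)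
  no-parity-test F def (inj₁ condA) = definable⇒¬oscillates e is-ε F def
    (parity-oscillates F card zero-only zero-and-one zero-only-bounded zero-and-one-bounded (0 , refl) (0 , refl) card-step condA)
  no-parity-test F def (inj₂ (inj₁ condB)) = definable⇒¬oscillates e is-ε F def
    (parity-oscillates F maxS zero-only one-only zero-only-bounded one-only-bounded (0 , refl) (1 , refl) max-step condB)
  no-parity-test F def (inj₂ (inj₂ condC)) = definable⇒¬oscillates e is-ε F def
    (parity-oscillates F sumS zero-only one-only zero-only-bounded one-only-bounded (0 , refl) (1 , refl) sum-step condC)
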